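{- Let $(D,\sqsubseteq)$ be a dcpo with the Scott topology, $B\subseteq D$, and $A\in\mathbf{\Delta}^0_2(D)$. Then every $A$-alternating $\sqsubseteq$-increasing $B$-tree is well-founded.
   Context: A dcpo is a poset in which every nonempty directed subset has a supremum; Scott open sets are upsets $O$ such that every directed set with supremum in $O$ meets $O$. $\mathbf{\Sigma}^0_2(D)$: countable unions of Boolean combinations of Scott open sets; $\mathbf{\Pi}^0_2(D)$: their complements; $\mathbf{\Delta}^0_2(D)=\mathbf{\Sigma}^0_2(D)\cap\mathbf{\Pi}^0_2(D)$. A tree is a nonempty set $T$ of finite sequences closed under prefixes; it is well-founded if it has no infinite branch. A $B$-tree is a map $f:T\to B$ with $T$ a tree. It is $A$-alternating if for all $\sigma$ and immediate extensions $\sigma n$ in $T$, $f(\sigma n)\in A\iff f(\sigma)\notin A$; it is $\sqsubseteq$-increasing if $f(\sigma)\sqsubseteq f(\sigma n)$ for all such $\sigma,\sigma n\in T$. The $B$-tree is called well-founded if $T$ is. -}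

module Defs where

open import Level using (Level; _⊔_) renaming (suc to lsuc)
open import Data.Nat using (ℕ)
open import Data.List using (List; []; _++_; _∷ʳ_; applyUpTo)
open import Data.Product using (Σ; ∃; ∃-syntax; _×_; _,_)
open import Relation.Nullary using (¬_)
open import Relation.Unary using (Pred; _∈_; _∉_)
open import Relation.Binary.Bundles using (Poset)
open import Function.Bundles using (_⇔_)

module _ {ℓ : Level} (D : Poset ℓ ℓ ℓ) where
  open Poset D renaming (Carrier to X; _≤_ to _⊑_)

  Directed : Pred X ℓ → Set ℓ
  Directed S = (∃[ x ] (x ∈ S))
             × (∀ {x y} → x ∈ S → y ∈ S → ∃[ z ] (z ∈ S × x ⊑ z × y ⊑ z))

  IsUpperBound : Pred X ℓ → X → Set ℓ
  IsUpperBound S u = ∀ {s} → s ∈ S → s ⊑ u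

  IsSupremum : Pred X ℓ → X → Set ℓ
  IsSupremum S x = IsUpperBound S x × (∀ u → IsUpperBound S u → x ⊑ u)

  IsDcpo : Set (lsuc ℓ)
  IsDcpo = ∀ (S : Pred X ℓ) → Directed S → ∃[ x ] IsSupremum S x

  IsUpset : Pred X ℓ → Set ℓ
  IsUpset O = ∀ {x y} → x ⊑ y → x ∈ O → y ∈ O

  IsScottOpen : Pred X ℓ → Set (lsuc ℓ)
  IsScottOpen O = IsUpset O
    × (∀ (S : Pred X ℓ) (x : X) → Directed S → IsSupremum S x → x ∈ O
         → ∃[ s ] (s ∈ S × s ∈ O))

  data BoolComb : Set (lsuc ℓ) where
    open′ : (U : Pred X ℓ) → IsScottOpen U → BoolComb
    ∁′    : BoolComb → BoolComb
    _∩′_  : BoolComb → BoolComb → BoolComb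
    _∪′_  : BoolComb → BoolComb → BoolComb

  ⟦_⟧ : BoolComb → Pred X ℓ
  ⟦ open′ U _ ⟧ x = U x
  ⟦ ∁′ C ⟧ x = ¬ (⟦ C ⟧ x)
  ⟦ C ∩′ C′ ⟧ x = ⟦ C ⟧ x × ⟦ C′ ⟧ x
  ⟦ C ∪′ C′ ⟧ x = Data.Sum._⊎_ (⟦ C ⟧ x) (⟦ C′ ⟧ x)
    where import Data.Sum

  IsΣ⁰₂ : Pred X ℓ → Set (lsuc ℓ)
  IsΣ⁰₂ A = Σ (ℕ → BoolComb) λ C → (∀ x → (x ∈ A) ⇔ (∃[ n ] (x ∈ ⟦ C n ⟧)))

  IsΠ⁰₂ : Pred X ℓ → Set (lsuc ℓ)
  IsΠ⁰₂ A = IsΣ⁰₂ (λ x → x ∉ A)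

  IsΔ⁰₂ : Pred X ℓ → Set (lsuc ℓ)
  IsΔ⁰₂ A = IsΣ⁰₂ A × IsΠ⁰₂ A

IsTree : ∀ {t} → Pred (List ℕ) t → Set t
IsTree T = (∃[ σ ] (σ ∈ T)) × (∀ σ τ → (σ ++ τ) ∈ T → σ ∈ T)

prefix : (ℕ → ℕ) → ℕ → List ℕ
prefix α n = applyUpTo α n

WellFoundedTree : ∀ {t} → Pred (List ℕ) t → Set t
WellFoundedTree T = ¬ (∃[ α ] (∀ n → prefix α n ∈ T))

module _ {ℓ t : Level} (D : Poset ℓ ℓ ℓ) where
  open Poset D renaming (Carrier to X; _≤_ to _⊑_)

  -- a B-tree is a map f : T → B; we represent it as f : ∀ σ → σ ∈ T → X
  -- together with the proof that all its values lie in B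
  IsBTree : (B : Pred X ℓ) (T : Pred (List ℕ) t) → (∀ σ → σ ∈ T → X) → Set (ℓ Level.⊔ t)
  IsBTree B T f = ∀ σ (p : σ ∈ T) → f σ p ∈ B

  IsAlternating : (A : Pred X ℓ) (T : Pred (List ℕ) t) → (∀ σ → σ ∈ T → X) → Set (ℓ Level.⊔ t)
  IsAlternating A T f = ∀ σ n (p : σ ∈ T) (q : (σ ∷ʳ n) ∈ T)
    → (f (σ ∷ʳ n) q ∈ A) ⇔ (f σ p ∉ A)

  IsIncreasing : (T : Pred (List ℕ) t) → (∀ σ → σ ∈ T → X) → Set (ℓ Level.⊔ t)
  IsIncreasing T f = ∀ σ n (p : σ ∈ T) (q : (σ ∷ʳ n) ∈ T) → f σ p ⊑ f (σ ∷ʳ n) q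

-- Along an infinite branch α the labels x n = f (α↾n) form an increasing
-- chain, with supremum s in the dcpo. Every Boolean combination of Scott
-- open sets eventually agrees, along the chain, with its truth value at s:
-- an open set containing s already contains some x N, hence all later ones,
-- and an open set avoiding s avoids the whole chain. Consequently a Σ⁰₂ set
-- containing s eventually contains the chain. Since A and its complement are
-- both Σ⁰₂, one of them eventually contains the chain, which is impossible
-- as the labels alternate in and out of A. The case split on s ∈ A is
-- classical, so the argument runs in the double-negation monad. Neither the
-- label set B nor the prefix-closure of T plays any role.
module Submission where

open import Defs
open import Level using (Level)
open import Data.Nat using (ℕ; suc; _≤_; _≤′_; ≤′-refl; ≤′-step; _⊔_)
open import Data.Nat.Properties using (≤-refl; ≤-trans; n≤1+n; m≤m⊔n; m≤n⊔m; ≤⇒≤′)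
open import Data.List using (List; _∷ʳ_)
open import Data.List.Properties using (applyUpTo-∷ʳ)
open import Data.Product using (∃-syntax; _×_; _,_; proj₁; proj₂)
open import Data.Sum using (_⊎_) renaming (map to ⊎-map)
open import Function using (_∘_)
open import Function.Bundles using (_⇔_; mk⇔; Equivalence)
open import Effect.Monad using (RawMonad)
open import Relation.Nullary using (¬_; Dec; yes; no)
open import Relation.Nullary.Decidable using (¬¬-excluded-middle)
open import Relation.Nullary.Negation using (contradiction; ¬¬-Monad)
open import Relation.Unary using (Pred; _∈_; _∉_)
open import Relation.Binary.Bundles using (Poset)
open import Relation.Binary.PropositionalEquality using (_≡_; refl; sym; subst)
open import Relation.Binary.PropositionalEquality.Properties using (dcong₂)

open Equivalence using (to; from)

Eventually : ∀ {p} → Pred ℕ p → Set p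
Eventually P = ∃[ N ] (∀ n → N ≤ n → P n)

eventually-× : ∀ {p q} {P : Pred ℕ p} {Q : Pred ℕ q}
  → Eventually P → Eventually Q → Eventually (λ n → P n × Q n)
eventually-× (N , p) (M , q) =
  N ⊔ M , λ n N⊔M≤n → p n (≤-trans (m≤m⊔n N M) N⊔M≤n) , q n (≤-trans (m≤n⊔m N M) N⊔M≤n)

module _ {p} {P : Pred ℕ p} (alternates : ∀ n → P (suc n) ⇔ (¬ P n)) where

  alternating⇒¬eventually : ¬ Eventually P
  alternating⇒¬eventually (N , p) = to (alternates N) (p (suc N) (n≤1+n N)) (p N ≤-refl)

  alternating⇒¬eventually-¬ : ¬ Eventually (¬_ ∘ P)
  alternating⇒¬eventually-¬ (N , ¬p) = ¬p (suc N) (n≤1+n N) (from (alternates N) (¬p N ≤-refl))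

module _ {ℓ : Level} (D : Poset ℓ ℓ ℓ) where
  open Poset D using () renaming (Carrier to X; _≤_ to _⊑_; refl to ⊑-refl; trans to ⊑-trans)

  IsChain : (ℕ → X) → Set ℓ
  IsChain x = ∀ n → x n ⊑ x (suc n)

  Range : (ℕ → X) → Pred X ℓ
  Range x y = ∃[ n ] (x n ≡ y)

  module _ {x : ℕ → X} (chain : IsChain x) where

    chain-mono′ : ∀ {m n} → m ≤′ n → x m ⊑ x n
    chain-mono′ ≤′-refl        = ⊑-refl
    chain-mono′ (≤′-step m≤′n) = ⊑-trans (chain-mono′ m≤′n) (chain _)

    chain-mono : ∀ {m n} → m ≤ n → x m ⊑ x n
    chain-mono = chain-mono′ ∘ ≤⇒≤′

    chain-directed : Directed D (Range x)
    chain-directed = (x 0 , 0 , refl) , λ where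
      (m , refl) (n , refl) →
        x (m ⊔ n) , (m ⊔ n , refl) , chain-mono (m≤m⊔n m n) , chain-mono (m≤n⊔m m n)

  module Limit {x : ℕ → X} (chain : IsChain x) {s : X} (s-sup : IsSupremum D (Range x) s) where

    open RawMonad (¬¬-Monad {ℓ})

    Stabilises : Pred X ℓ → Set ℓ
    Stabilises P = Eventually (λ n → P (x n) ⇔ P s)

    x≤s : ∀ n → x n ⊑ s
    x≤s n = proj₁ s-sup (n , refl)

    scottOpen-stabilises : ∀ {U} → IsScottOpen D U → ¬ ¬ Stabilises U
    scottOpen-stabilises {U} (upset , inaccessible) = stabilises <$> ¬¬-excluded-middle
      where
      stabilises : Dec (s ∈ U) → Stabilises U
      stabilises (yes s∈U) with inaccessible (Range x) s (chain-directed chain) s-sup s∈U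
      ... | _ , (N , refl) , xN∈U =
        N , λ n N≤n → mk⇔ (λ _ → s∈U) (λ _ → upset (chain-mono chain N≤n) xN∈U)
      stabilises (no s∉U) =
        0 , λ n _ → mk⇔ (λ xn∈U → upset (x≤s n) xn∈U) (λ s∈U → contradiction s∈U s∉U)

    ∁-stabilises : ∀ {P} → Stabilises P → Stabilises (λ y → y ∉ P)
    ∁-stabilises (N , agree) =
      N , λ n N≤n → mk⇔ (λ ¬p → ¬p ∘ from (agree n N≤n)) (λ ¬p → ¬p ∘ to (agree n N≤n))

    ∩-stabilises : ∀ {P Q} → Stabilises P → Stabilises Q → Stabilises (λ y → P y × Q y)
    ∩-stabilises sP sQ = proj₁ both , λ n N≤n → let (p , q) = proj₂ both n N≤n in
      mk⇔ (λ (a , b) → to p a , to q b) (λ (a , b) → from p a , from q b)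
      where both = eventually-× sP sQ

    ∪-stabilises : ∀ {P Q} → Stabilises P → Stabilises Q → Stabilises (λ y → P y ⊎ Q y)
    ∪-stabilises sP sQ = proj₁ both , λ n N≤n → let (p , q) = proj₂ both n N≤n in
      mk⇔ (⊎-map (to p) (to q)) (⊎-map (from p) (from q))
      where both = eventually-× sP sQ

    boolComb-stabilises : ∀ C → ¬ ¬ Stabilises (⟦_⟧ D C)
    boolComb-stabilises (open′ U open-U) = scottOpen-stabilises open-U
    boolComb-stabilises (∁′ C)           = ∁-stabilises <$> boolComb-stabilises C
    boolComb-stabilises (C ∩′ C′)        = zipWith ∩-stabilises (boolComb-stabilises C) (boolComb-stabilises C′)
    boolComb-stabilises (C ∪′ C′)        = zipWith ∪-stabilises (boolComb-stabilises C) (boolComb-stabilises C′)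

    Σ⁰₂-eventually : ∀ {A} → IsΣ⁰₂ D A → s ∈ A → ¬ ¬ Eventually (λ n → x n ∈ A)
    Σ⁰₂-eventually {A} (C , A≡⋃C) s∈A with to (A≡⋃C s) s∈A
    ... | j , s∈Cj = eventually <$> boolComb-stabilises (C j)
      where
      eventually : Stabilises (⟦_⟧ D (C j)) → Eventually (λ n → x n ∈ A)
      eventually (N , agree) = N , λ n N≤n → from (A≡⋃C (x n)) (j , from (agree n N≤n) s∈Cj)

module Branch {ℓ t : Level} (D : Poset ℓ ℓ ℓ) {T : Pred (List ℕ) t}
  (f : ∀ σ → σ ∈ T → Poset.Carrier D) (α : ℕ → ℕ) (branch : ∀ n → prefix α n ∈ T) where

  open Poset D using () renaming (Carrier to X; _≤_ to _⊑_)

  label : ℕ → X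
  label n = f (prefix α n) (branch n)

  private
    extension : ∀ n → prefix α n ∷ʳ α n ≡ prefix α (suc n)
    extension n = applyUpTo-∷ʳ α n

    extension∈T : ∀ n → prefix α n ∷ʳ α n ∈ T
    extension∈T n = subst T (sym (extension n)) (branch (suc n))

    label-suc : ∀ n → label (suc n) ≡ f (prefix α n ∷ʳ α n) (extension∈T n)
    label-suc n = dcong₂ f (sym (extension n)) refl

  increasing⇒chain : IsIncreasing D T f → IsChain D label
  increasing⇒chain increasing n =
    subst (label n ⊑_) (sym (label-suc n)) (increasing _ (α n) (branch n) (extension∈T n))

  alternating⇒alternates : ∀ {A} → IsAlternating D A T f → ∀ n → label (suc n) ∈ A ⇔ label n ∉ A
  alternating⇒alternates {A} alternating n =
    subst (λ y → y ∈ A ⇔ label n ∉ A) (sym (label-suc n)) (alternating _ (α n) (branch n) (extension∈T n))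

proposition4p6 : ∀ {ℓ t : Level} (D : Poset ℓ ℓ ℓ) → IsDcpo D
    → (B A : Pred (Poset.Carrier D) ℓ) → IsΔ⁰₂ D A
    → (T : Pred (List ℕ) t) → IsTree T
    → (f : ∀ σ → T σ → Poset.Carrier D) → IsBTree D B T f
    → IsAlternating D A T f → IsIncreasing D T f
    → WellFoundedTree T
proposition4p6 D dcpo B A (A-Σ⁰₂ , A-Π⁰₂) T _ f _ alternating increasing (α , branch) =
  ¬¬-excluded-middle λ where
    (yes s∈A) → Σ⁰₂-eventually A-Σ⁰₂ s∈A (alternating⇒¬eventually alternates)
    (no s∉A)  → Σ⁰₂-eventually A-Π⁰₂ s∉A (alternating⇒¬eventually-¬ alternates)
  where
  open Branch D f α branch
  chain : IsChain D label
  chain = increasing⇒chain increasing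
  alternates : ∀ n → label (suc n) ∈ A ⇔ label n ∉ A
  alternates = alternating⇒alternates {A} alternating
  open Limit D chain (proj₂ (dcpo (Range D label) (chain-directed D chain)))
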